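{- Let $\lambda\neq0$ be a complex number, $d\in\mathbb{N}$, and $u\in\mathbb{C}$ with $u\neq0$, $u\neq1$ and $u^d\neq1$. For every integer $n\ge0$, \[ h_{n,\lambda}(x|u)=d^n\left(\frac{ -1+u^{ -1}}{1-u^d}\right)\sum_{a=0}^{d-1}u^{d-a}\,h_{n,\lambda/d}\!\left(\left.\frac{a+x}{d}\right|u^d\right). \]
   Context: For a complex number $\mu\neq0$ and a variable $x$, the degenerate falling factorial is $(x|\mu)_0=1$ and $(x|\mu)_n=x(x-\mu)\cdots(x-(n-1)\mu)$ for $n\ge1$. The symbol $(1+\mu t)^{x/\mu}$ denotes the formal power series $\sum_{n\ge0}(x|\mu)_n\frac{t^n}{n!}$. For $v\in\mathbb{C}$, $v\neq1$, the degenerate Frobenius–Euler polynomials $h_{n,\mu}(x|v)$ are defined by \[ \frac{1-v}{(1+\mu t)^{1/\mu}-v}(1+\mu t)^{x/\mu}=\sum_{n=0}^\infty h_{n,\mu}(x|v)\frac{t^n}{n!}. \] -}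

module Defs where

open import Level using (_⊔_) renaming (suc to lsuc)
open import Algebra.Bundles using (CommutativeRing)
open import Data.Nat using (ℕ; zero; suc; _∸_)
open import Data.Nat.Combinatorics using (_C_)
open import Relation.Nullary using (¬_)

module RingDefs {c ℓ} (R : CommutativeRing c ℓ) where
  open CommutativeRing R

  natR : ℕ → Carrier
  natR zero    = 0#
  natR (suc n) = 1# + natR n

  infixr 8 _^_
  _^_ : Carrier → ℕ → Carrier
  x ^ zero  = 1#
  x ^ suc n = x * (x ^ n)

  sumR : ℕ → (ℕ → Carrier) → Carrier
  sumR zero    f = 0#
  sumR (suc n) f = sumR n f + f n

  fall : Carrier → Carrier → ℕ → Carrier
  fall μ x zero    = 1#
  fall μ x (suc n) = fall μ x n * (x - natR n * μ)

  -- Exponential formal power series Σ a_n t^n/n! are represented by their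
  -- coefficient sequences a : ℕ → Carrier.  Their product has coefficients
  -- given by the binomial convolution.
  egfMul : (ℕ → Carrier) → (ℕ → Carrier) → ℕ → Carrier
  egfMul a b n = sumR (suc n) (λ k → natR (n C k) * (a k * b (n ∸ k)))

  -- the series (1+μt)^{x/μ} = Σ (x|μ)_n t^n/n!
  degExp : Carrier → Carrier → ℕ → Carrier
  degExp μ x n = fall μ x n

  constS : Carrier → ℕ → Carrier
  constS c zero    = c
  constS c (suc n) = 0#

  -- H is the coefficient sequence of the exponential generating function
  --   (1-v)/((1+μt)^{1/μ} - v) · (1+μt)^{x/μ},
  -- i.e. H n = h_{n,μ}(x|v).  Since the constant term 1-v of the
  -- denominator is invertible (v ≠ 1), this is equivalent to
  --   ((1+μt)^{1/μ} - v) · H = (1-v) (1+μt)^{x/μ}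
  -- and determines H uniquely.
  IsDegFrobEuler : Carrier → Carrier → Carrier → (ℕ → Carrier) → Set ℓ
  IsDegFrobEuler μ v x H =
    ∀ n → egfMul (λ k → degExp μ 1# k - constS v k) H n
          ≈ (1# - v) * degExp μ x n

-- A field of characteristic zero, presented as a commutative ring together
-- with an inverse operation that is a two-sided inverse on nonzero elements.
-- (The standard library has no bundle for fields and no complex numbers;
-- ℂ is an instance of this record.)
record CharZeroField (c ℓ : Level.Level) : Set (lsuc (c ⊔ ℓ)) where
  field
    commutativeRing : CommutativeRing c ℓ

  open CommutativeRing commutativeRing public
  open RingDefs commutativeRing public

  field
    _⁻¹        : Carrier → Carrier
    ⁻¹-cong    : ∀ {x y} → x ≈ y → x ⁻¹ ≈ y ⁻¹
    ⁻¹-inverse : ∀ x → ¬ (x ≈ 0#) → x * (x ⁻¹) ≈ 1#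
    charZero   : ∀ n → ¬ (natR (suc n) ≈ 0#)

module Submission where

-- EGFs Σ aₙ tⁿ/n! are coefficient sequences; egfMul is shown equal to the
-- Leibniz product (a ⋆ b)(n+1) = (a′ ⋆ b) n + (a ⋆ b′) n, whose ring laws are
-- short inductions.  With E y = (1+μt)^{y/μ} we prove, over any commutative
-- ring: Vandermonde E y ⋆ E z = E (y+z); t ↦ δt is multiplicative and sends
-- (1+(μ/δ)t)^{y/(μ/δ)} to E (δy); the telescoping sum (E 1 - u) ⋆ Q = u P for
-- Q = Σ_{a<d} u^{d-a} E a and P = E d - u^d; cancellation of series with
-- invertible constant term.  For Z = Σ_{a<d} u^{d-a} G_a(dt) the hypotheses
-- give P ⋆ Z = (1-u^d) Q ⋆ E x and (E 1 - u) ⋆ H = (1-u) E x, hence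
--   uP ⋆ H = (1-u) Q ⋆ E x = uP ⋆ (c Z),   c = (-1+u⁻¹)/(1-u^d),
-- and cancelling uP (constant term u(1-u^d)) yields H = c Z: this is
-- multiplication-formula, valid whenever d, u, 1-u^d are invertible.
-- theorem3 specialises it to fields of characteristic zero.

open import Defs
open import Algebra.Bundles using (CommutativeRing)
open import Data.Nat using (ℕ; zero; suc; _<_; _≤_; _∸_; s≤s)
  renaming (_+_ to _+ℕ_)
import Data.Nat.Properties as ℕₚ
open import Data.Nat.Combinatorics using (_C_; nCk+nC[k+1]≡[n+1]C[k+1]; k>n⇒nCk≡0)
open import Data.Nat.Induction using (<-rec)
open import Data.Empty using (⊥-elim)
open import Relation.Nullary using (¬_)
import Relation.Binary.PropositionalEquality as ≡
import Algebra.Properties.Ring as RingProperties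
import Algebra.Properties.Group as GroupProperties
import Algebra.Properties.AbelianGroup as AbelianGroupProperties
import Algebra.Properties.CommutativeSemigroup as CommSemigroupProperties
import Algebra.Solver.Ring.NaturalCoefficients.Default as SemiringSolver
import Relation.Binary.Reasoning.Setoid as SetoidReasoning

module SeriesAlgebra {r₁ r₂} (R : CommutativeRing r₁ r₂) where
  open CommutativeRing R hiding (zero)
  open RingDefs R
  open SetoidReasoning setoid
  open SemiringSolver commutativeSemiring using (solve; _:=_; _:+_; _:*_)
  module RP = RingProperties ring
  module +G = GroupProperties +-group
  module +A = AbelianGroupProperties +-abelianGroup
  module +C = CommSemigroupProperties +-commutativeSemigroup
  module *C = CommSemigroupProperties *-commutativeSemigroup

  sub-+ : ∀ y a b → y - (a + b) ≈ (y - a) - b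
  sub-+ y a b = trans (+-cong refl (sym (+A.⁻¹-∙-comm a b))) (sym (+-assoc y (- a) (- b)))

  cancel-middle : ∀ p q b → (p - q) + (b - p) ≈ b - q
  cancel-middle p q b = begin
    (p - q) + (b - p)   ≈⟨ rearrange p (- q) b (- p) ⟩
    (b - q) + (p - p)   ≈⟨ +-cong refl (-‿inverseʳ p) ⟩
    (b - q) + 0#        ≈⟨ +-identityʳ _ ⟩
    b - q ∎
    where
    rearrange : ∀ p nq b np → (p + nq) + (b + np) ≈ (b + nq) + (p + np)
    rearrange = solve 4 (λ p nq b np → (p :+ nq) :+ (b :+ np) := (b :+ nq) :+ (p :+ np)) refl

  sumR-cong : ∀ n {f g : ℕ → Carrier} → (∀ k → k < n → f k ≈ g k) → sumR n f ≈ sumR n g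
  sumR-cong zero    f≈g = refl
  sumR-cong (suc n) f≈g = +-cong (sumR-cong n (λ k k<n → f≈g k (ℕₚ.m<n⇒m<1+n k<n))) (f≈g n (ℕₚ.n<1+n n))

  sumR-+ : ∀ n (f g : ℕ → Carrier) → sumR n (λ k → f k + g k) ≈ sumR n f + sumR n g
  sumR-+ zero    f g = sym (+-identityʳ 0#)
  sumR-+ (suc n) f g = trans (+-cong (sumR-+ n f g) refl) (+C.interchange _ _ _ _)

  sumR-* : ∀ n s (f : ℕ → Carrier) → sumR n (λ k → s * f k) ≈ s * sumR n f
  sumR-* zero    s f = sym (zeroʳ s)
  sumR-* (suc n) s f = trans (+-cong (sumR-* n s f) refl) (sym (distribˡ s _ _))

  sumR-first : ∀ n (f : ℕ → Carrier) → sumR (suc n) f ≈ f 0 + sumR n (λ k → f (suc k))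
  sumR-first zero    f = +-comm 0# (f 0)
  sumR-first (suc n) f = trans (+-cong (sumR-first n f) refl) (+-assoc _ _ _)

  weighted-sum-step : ∀ u m (f : ℕ → Carrier) →
    sumR (suc m) (λ a → u ^ (suc m ∸ a) * f a) ≈ u * (sumR m (λ a → u ^ (m ∸ a) * f a) + f m)
  weighted-sum-step u m f = begin
    sumR m (λ a → u ^ (suc m ∸ a) * f a) + u ^ (suc m ∸ m) * f m
      ≈⟨ +-cong (sumR-cong m (λ a a<m → trans (*-cong (exponent a<m) refl) (*-assoc _ _ _)))
                (*-cong (trans (reflexive (≡.cong (u ^_) (ℕₚ.m+n∸n≡m 1 m))) (*-identityʳ u)) refl) ⟩
    sumR m (λ a → u * (u ^ (m ∸ a) * f a)) + u * f m
      ≈⟨ +-cong (sumR-* m u _) refl ⟩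
    u * sumR m (λ a → u ^ (m ∸ a) * f a) + u * f m
      ≈⟨ sym (distribˡ u _ _) ⟩
    u * (sumR m (λ a → u ^ (m ∸ a) * f a) + f m) ∎
    where
    exponent : ∀ {a} → a < m → u ^ (suc m ∸ a) ≈ u ^ suc (m ∸ a)
    exponent a<m = reflexive (≡.cong (u ^_) (ℕₚ.+-∸-assoc 1 (ℕₚ.<⇒≤ a<m)))

  natR-+ : ∀ m n → natR (m +ℕ n) ≈ natR m + natR n
  natR-+ zero    n = sym (+-identityˡ _)
  natR-+ (suc m) n = trans (+-cong refl (natR-+ m n)) (sym (+-assoc _ _ _))

  Seq : Set r₁
  Seq = ℕ → Carrier

  infix  4 _≋_
  infixl 7 _·_ _⋆_
  infixl 6 _⊕_ _⊖_

  _≋_ : Seq → Seq → Set r₂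
  a ≋ b = ∀ n → a n ≈ b n

  _⊕_ _⊖_ : Seq → Seq → Seq
  (a ⊕ b) n = a n + b n
  (a ⊖ b) n = a n - b n

  _·_ : Carrier → Seq → Seq
  (s · a) n = s * a n

  Σˢ : ℕ → (ℕ → Seq) → Seq
  Σˢ m f n = sumR m (λ i → f i n)

  -- the derivative d/dt of Σ aₙ tⁿ/n!
  shift : Seq → Seq
  shift a n = a (suc n)

  -- The product of EGFs, defined through the Leibniz rule (ab)′ = a′b + ab′.
  _⋆_ : Seq → Seq → Seq
  (a ⋆ b) zero    = a 0 * b 0
  (a ⋆ b) (suc n) = (shift a ⋆ b) n + (a ⋆ shift b) n

  -- One step of the binomial convolution is the Leibniz rule (Pascal's rule).
  egfMul-step : ∀ n (a b : Seq) → egfMul a b (suc n) ≈ egfMul (shift a) b n + egfMul a (shift b) n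
  egfMul-step n a b = begin
    sumR (suc (suc n)) f
      ≈⟨ sumR-first (suc n) f ⟩
    f 0 + sumR (suc n) (λ k → f (suc k))
      ≈⟨ +-cong refl (trans (sumR-cong (suc n) (λ k _ → pascal k)) (sumR-+ (suc n) g₁ g₂)) ⟩
    f 0 + (sumR (suc n) g₁ + sumR (suc n) g₂)
      ≈⟨ +-cong refl (+-cong refl g₂-sum) ⟩
    h 0 + (sumR (suc n) g₁ + sumR n (λ k → h (suc k)))
      ≈⟨ +C.x∙yz≈y∙xz _ _ _ ⟩
    sumR (suc n) g₁ + (h 0 + sumR n (λ k → h (suc k)))
      ≈⟨ +-cong refl (sym (sumR-first n h)) ⟩
    egfMul (shift a) b n + egfMul a (shift b) n ∎
    where
    f g₁ g₂ h : ℕ → Carrier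
    f  k = natR (suc n C k) * (a k * b (suc n ∸ k))
    g₁ k = natR (n C k) * (a (suc k) * b (n ∸ k))
    g₂ k = natR (n C suc k) * (a (suc k) * b (n ∸ k))
    h  k = natR (n C k) * (a k * b (suc (n ∸ k)))

    -- (f 0 and h 0 agree definitionally, since n C 0 reduces to 1)
    pascal : ∀ k → f (suc k) ≈ g₁ k + g₂ k
    pascal k = trans (*-cong (trans (reflexive (≡.cong natR (≡.sym (nCk+nC[k+1]≡[n+1]C[k+1] n k))))
                                    (natR-+ (n C k) (n C suc k))) refl)
                     (distribʳ _ _ _)

    -- the term k = n of g₂ vanishes, the others are the terms k ≥ 1 of h
    g₂-sum : sumR (suc n) g₂ ≈ sumR n (λ k → h (suc k))
    g₂-sum = trans (+-cong (sumR-cong n (λ k k<n → *-cong refl (*-cong refl (reflexive (≡.cong b (index k<n))))))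
                           (trans (*-cong (reflexive (≡.cong natR (k>n⇒nCk≡0 (ℕₚ.n<1+n n)))) refl) (zeroˡ _)))
                   (+-identityʳ _)
      where
      index : ∀ {k} → k < n → n ∸ k ≡.≡ suc (n ∸ suc k)
      index k<n = ℕₚ.+-∸-assoc 1 k<n

  egfMul≈⋆ : ∀ (a b : Seq) → egfMul a b ≋ a ⋆ b
  egfMul≈⋆ a b zero    = trans (+-identityˡ _) (trans (*-cong (+-identityʳ 1#) refl) (*-identityˡ _))
  egfMul≈⋆ a b (suc n) = trans (egfMul-step n a b) (+-cong (egfMul≈⋆ (shift a) b n) (egfMul≈⋆ a (shift b) n))

  ⋆-cong : ∀ {a a′ b b′ : Seq} → a ≋ a′ → b ≋ b′ → a ⋆ b ≋ a′ ⋆ b′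
  ⋆-cong a≋a′ b≋b′ zero    = *-cong (a≋a′ 0) (b≋b′ 0)
  ⋆-cong a≋a′ b≋b′ (suc n) = +-cong (⋆-cong (λ k → a≋a′ (suc k)) b≋b′ n) (⋆-cong a≋a′ (λ k → b≋b′ (suc k)) n)

  ⋆-comm : ∀ (a b : Seq) → a ⋆ b ≋ b ⋆ a
  ⋆-comm a b zero    = *-comm (a 0) (b 0)
  ⋆-comm a b (suc n) = trans (+-cong (⋆-comm (shift a) b n) (⋆-comm a (shift b) n)) (+-comm _ _)

  ⋆-⊕ˡ : ∀ (a b c : Seq) → (a ⊕ b) ⋆ c ≋ a ⋆ c ⊕ b ⋆ c
  ⋆-⊕ˡ a b c zero    = distribʳ (c 0) (a 0) (b 0)
  ⋆-⊕ˡ a b c (suc n) = trans (+-cong (⋆-⊕ˡ (shift a) (shift b) c n) (⋆-⊕ˡ a b (shift c) n)) (+C.interchange _ _ _ _)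

  ⋆-·ˡ : ∀ s (a b : Seq) → (s · a) ⋆ b ≋ s · (a ⋆ b)
  ⋆-·ˡ s a b zero    = *-assoc s (a 0) (b 0)
  ⋆-·ˡ s a b (suc n) = trans (+-cong (⋆-·ˡ s (shift a) b n) (⋆-·ˡ s a (shift b) n)) (sym (distribˡ s _ _))

  ⋆-⊕ʳ : ∀ (a b c : Seq) → a ⋆ (b ⊕ c) ≋ a ⋆ b ⊕ a ⋆ c
  ⋆-⊕ʳ a b c n = trans (⋆-comm a _ n) (trans (⋆-⊕ˡ b c a n) (+-cong (⋆-comm b a n) (⋆-comm c a n)))

  ⋆-·ʳ : ∀ s (a b : Seq) → a ⋆ (s · b) ≋ s · (a ⋆ b)
  ⋆-·ʳ s a b n = trans (⋆-comm a _ n) (trans (⋆-·ˡ s b a n) (*-cong refl (⋆-comm b a n)))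

  ⊖≋⊕-1· : ∀ (a b : Seq) → a ⊖ b ≋ a ⊕ (- 1#) · b
  ⊖≋⊕-1· a b n = +-cong refl (sym (RP.-1*x≈-x (b n)))

  ⋆-⊖ˡ : ∀ (a b c : Seq) → (a ⊖ b) ⋆ c ≋ a ⋆ c ⊖ b ⋆ c
  ⋆-⊖ˡ a b c n = begin
    ((a ⊖ b) ⋆ c) n                 ≈⟨ ⋆-cong (⊖≋⊕-1· a b) (λ _ → refl) n ⟩
    ((a ⊕ (- 1#) · b) ⋆ c) n        ≈⟨ ⋆-⊕ˡ a _ c n ⟩
    (a ⋆ c) n + ((- 1#) · b ⋆ c) n  ≈⟨ +-cong refl (⋆-·ˡ (- 1#) b c n) ⟩
    (a ⋆ c ⊕ (- 1#) · (b ⋆ c)) n    ≈⟨ sym (⊖≋⊕-1· (a ⋆ c) (b ⋆ c) n) ⟩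
    (a ⋆ c ⊖ b ⋆ c) n ∎

  ⋆-⊖ʳ : ∀ (a b c : Seq) → a ⋆ (b ⊖ c) ≋ a ⋆ b ⊖ a ⋆ c
  ⋆-⊖ʳ a b c n = trans (⋆-comm a _ n) (trans (⋆-⊖ˡ b c a n) (+-cong (⋆-comm b a n) (-‿cong (⋆-comm c a n))))

  ⋆-vanishes : ∀ (a b : Seq) n → (∀ k → k ≤ n → b k ≈ 0#) → (a ⋆ b) n ≈ 0#
  ⋆-vanishes a b zero    b≈0 = trans (*-cong refl (b≈0 0 ℕₚ.≤-refl)) (zeroʳ _)
  ⋆-vanishes a b (suc n) b≈0 =
    trans (+-cong (⋆-vanishes (shift a) b n (λ k k≤n → b≈0 k (ℕₚ.m≤n⇒m≤1+n k≤n)))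
                  (⋆-vanishes a (shift b) n (λ k k≤n → b≈0 (suc k) (s≤s k≤n))))
          (+-identityʳ 0#)

  ⋆-leading : ∀ (a b : Seq) n → (∀ k → k < n → b k ≈ 0#) → (a ⋆ b) n ≈ a 0 * b n
  ⋆-leading a b zero    b≈0 = refl
  ⋆-leading a b (suc n) b≈0 =
    trans (+-cong (⋆-vanishes (shift a) b n (λ k k≤n → b≈0 k (s≤s k≤n)))
                  (⋆-leading a (shift b) n (λ k k<n → b≈0 (suc k) (s≤s k<n))))
          (+-identityˡ _)

  ⋆-constˡ : ∀ s (b : Seq) → constS s ⋆ b ≋ s · b
  ⋆-constˡ s b zero    = refl
  ⋆-constˡ s b (suc n) =
    trans (+-cong (trans (⋆-comm _ b n) (⋆-vanishes b (shift (constS s)) n (λ _ _ → refl)))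
                  (⋆-constˡ s (shift b) n))
          (+-identityˡ _)

  ⋆-assoc : ∀ (a b c : Seq) → (a ⋆ b) ⋆ c ≋ a ⋆ (b ⋆ c)
  ⋆-assoc a b c zero    = *-assoc (a 0) (b 0) (c 0)
  ⋆-assoc a b c (suc n) = begin
    ((shift a ⋆ b ⊕ a ⋆ shift b) ⋆ c ⊕ (a ⋆ b) ⋆ shift c) n
      ≈⟨ +-cong (⋆-⊕ˡ (shift a ⋆ b) (a ⋆ shift b) c n) (⋆-assoc a b (shift c) n) ⟩
    ((shift a ⋆ b) ⋆ c ⊕ (a ⋆ shift b) ⋆ c ⊕ a ⋆ (b ⋆ shift c)) n
      ≈⟨ +-cong (+-cong (⋆-assoc (shift a) b c n) (⋆-assoc a (shift b) c n)) refl ⟩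
    (shift a ⋆ (b ⋆ c) ⊕ a ⋆ (shift b ⋆ c) ⊕ a ⋆ (b ⋆ shift c)) n
      ≈⟨ +-assoc _ _ _ ⟩
    (shift a ⋆ (b ⋆ c)) n + (a ⋆ (shift b ⋆ c) ⊕ a ⋆ (b ⋆ shift c)) n
      ≈⟨ +-cong refl (sym (⋆-⊕ʳ a (shift b ⋆ c) (b ⋆ shift c) n)) ⟩
    (a ⋆ (b ⋆ c)) (suc n) ∎

  ⋆-Σˢʳ : ∀ (a : Seq) m (f : ℕ → Seq) → a ⋆ Σˢ m f ≋ Σˢ m (λ i → a ⋆ f i)
  ⋆-Σˢʳ a zero    f n = ⋆-vanishes a (Σˢ zero f) n (λ _ _ → refl)
  ⋆-Σˢʳ a (suc m) f n = trans (⋆-⊕ʳ a (Σˢ m f) (f m) n) (+-cong (⋆-Σˢʳ a m f n) refl)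

  ⋆-Σˢˡ : ∀ m (f : ℕ → Seq) (b : Seq) → Σˢ m f ⋆ b ≋ Σˢ m (λ i → f i ⋆ b)
  ⋆-Σˢˡ m f b n = trans (⋆-comm _ b n) (trans (⋆-Σˢʳ b m f n) (sumR-cong m (λ i _ → ⋆-comm b (f i) n)))

  -- A series whose constant term has an inverse is not a zero divisor:
  -- the n-th coefficient of a ⋆ e determines eₙ once e₀, …, e_{n-1} are known.
  ⋆-cancel-zero : ∀ (a e : Seq) ai → ai * a 0 ≈ 1# → (∀ n → (a ⋆ e) n ≈ 0#) → ∀ n → e n ≈ 0#
  ⋆-cancel-zero a e ai inverse a⋆e≈0 = <-rec (λ n → e n ≈ 0#) step
    where
    step : ∀ n → (∀ {k} → k < n → e k ≈ 0#) → e n ≈ 0#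
    step n below = begin
      e n                ≈⟨ sym (*-identityˡ (e n)) ⟩
      1# * e n           ≈⟨ *-cong (sym inverse) refl ⟩
      (ai * a 0) * e n   ≈⟨ *-assoc ai (a 0) (e n) ⟩
      ai * (a 0 * e n)   ≈⟨ *-cong refl (sym (⋆-leading a e n (λ k k<n → below k<n))) ⟩
      ai * (a ⋆ e) n     ≈⟨ *-cong refl (a⋆e≈0 n) ⟩
      ai * 0#            ≈⟨ zeroʳ ai ⟩
      0# ∎

  ⋆-cancelˡ : ∀ (a y z : Seq) ai → ai * a 0 ≈ 1# → a ⋆ y ≋ a ⋆ z → y ≋ z
  ⋆-cancelˡ a y z ai inverse a⋆y≈a⋆z n =
    +G.x∙y⁻¹≈ε⇒x≈y (y n) (z n) (⋆-cancel-zero a (y ⊖ z) ai inverse a⋆[y-z]≈0 n)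
    where
    a⋆[y-z]≈0 : ∀ n → (a ⋆ (y ⊖ z)) n ≈ 0#
    a⋆[y-z]≈0 n = trans (⋆-⊖ʳ a y z n) (trans (+-cong (a⋆y≈a⋆z n) refl) (-‿inverseʳ _))

  -- The degenerate exponential  fall μ y = (1+μt)^{y/μ}.

  fall-cong : ∀ μ {y z} → y ≈ z → fall μ y ≋ fall μ z
  fall-cong μ y≈z zero    = refl
  fall-cong μ y≈z (suc n) = *-cong (fall-cong μ y≈z n) (+-cong y≈z refl)

  fall-shift : ∀ μ y → shift (fall μ y) ≋ y · fall μ (y - μ)
  fall-shift μ y zero    = trans (*-identityˡ _) (trans (+-cong refl (trans (-‿cong (zeroˡ μ)) +A.ε⁻¹≈ε))
                                                          (trans (+-identityʳ y) (sym (*-identityʳ y))))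
  fall-shift μ y (suc n) = begin
    fall μ y (suc n) * (y - (1# + natR n) * μ)
      ≈⟨ *-cong (fall-shift μ y n) (+-cong refl (-‿cong (trans (distribʳ μ 1# (natR n)) (+-cong (*-identityˡ μ) refl)))) ⟩
    (y * fall μ (y - μ) n) * (y - (μ + natR n * μ))
      ≈⟨ *-cong refl (sub-+ y μ (natR n * μ)) ⟩
    (y * fall μ (y - μ) n) * ((y - μ) - natR n * μ)
      ≈⟨ *-assoc _ _ _ ⟩
    y * fall μ (y - μ) (suc n) ∎

  fall-zero : ∀ μ → fall μ 0# ≋ constS 1#
  fall-zero μ zero    = refl
  fall-zero μ (suc n) = trans (fall-shift μ 0# n) (zeroˡ _)

  fall-⋆ : ∀ μ y z → fall μ y ⋆ fall μ z ≋ fall μ (y + z)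
  fall-⋆ μ y z zero    = *-identityˡ 1#
  fall-⋆ μ y z (suc n) = begin
    (shift (fall μ y) ⋆ fall μ z) n + (fall μ y ⋆ shift (fall μ z)) n
      ≈⟨ +-cong (⋆-cong (fall-shift μ y) (λ _ → refl) n) (⋆-cong (λ _ → refl) (fall-shift μ z) n) ⟩
    ((y · fall μ (y - μ)) ⋆ fall μ z) n + (fall μ y ⋆ (z · fall μ (z - μ))) n
      ≈⟨ +-cong (⋆-·ˡ y _ _ n) (⋆-·ʳ z _ _ n) ⟩
    y * (fall μ (y - μ) ⋆ fall μ z) n + z * (fall μ y ⋆ fall μ (z - μ)) n
      ≈⟨ +-cong (*-cong refl (fall-⋆ μ (y - μ) z n)) (*-cong refl (fall-⋆ μ y (z - μ) n)) ⟩
    y * fall μ ((y - μ) + z) n + z * fall μ (y + (z - μ)) n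
      ≈⟨ +-cong (*-cong refl (fall-cong μ (+C.xy∙z≈xz∙y y (- μ) z) n))
                (*-cong refl (fall-cong μ (sym (+-assoc y z (- μ))) n)) ⟩
    y * fall μ ((y + z) - μ) n + z * fall μ ((y + z) - μ) n
      ≈⟨ sym (distribʳ _ y z) ⟩
    (y + z) * fall μ ((y + z) - μ) n
      ≈⟨ sym (fall-shift μ (y + z) n) ⟩
    fall μ (y + z) (suc n) ∎

  -- The substitution t ↦ δt, i.e. aₙ ↦ δⁿ aₙ.

  dilate : Carrier → Seq → Seq
  dilate δ a n = δ ^ n * a n

  dilate-⋆ : ∀ δ (a b : Seq) → dilate δ (a ⋆ b) ≋ dilate δ a ⋆ dilate δ b
  dilate-⋆ δ a b zero    = trans (*-identityˡ _) (sym (*-cong (*-identityˡ (a 0)) (*-identityˡ (b 0))))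
  dilate-⋆ δ a b (suc n) = begin
    (δ * δ ^ n) * ((shift a ⋆ b) n + (a ⋆ shift b) n)
      ≈⟨ expand δ (δ ^ n) _ _ ⟩
    δ * (δ ^ n * (shift a ⋆ b) n) + δ * (δ ^ n * (a ⋆ shift b) n)
      ≈⟨ +-cong (*-cong refl (dilate-⋆ δ (shift a) b n)) (*-cong refl (dilate-⋆ δ a (shift b) n)) ⟩
    δ * (dilate δ (shift a) ⋆ dilate δ b) n + δ * (dilate δ a ⋆ dilate δ (shift b)) n
      ≈⟨ sym (+-cong (⋆-·ˡ δ _ _ n) (⋆-·ʳ δ _ _ n)) ⟩
    ((δ · dilate δ (shift a)) ⋆ dilate δ b) n + (dilate δ a ⋆ (δ · dilate δ (shift b))) n
      ≈⟨ +-cong (⋆-cong (shift-dilate a) (λ _ → refl) n) (⋆-cong (λ _ → refl) (shift-dilate b) n) ⟩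
    (dilate δ a ⋆ dilate δ b) (suc n) ∎
    where
    expand : ∀ d p x y → (d * p) * (x + y) ≈ d * (p * x) + d * (p * y)
    expand = solve 4 (λ d p x y → (d :* p) :* (x :+ y) := d :* (p :* x) :+ d :* (p :* y)) refl

    shift-dilate : ∀ (c : Seq) → δ · dilate δ (shift c) ≋ shift (dilate δ c)
    shift-dilate c k = sym (*-assoc _ _ _)

  dilate-const : ∀ δ s → dilate δ (constS s) ≋ constS s
  dilate-const δ s zero    = *-identityˡ s
  dilate-const δ s (suc n) = zeroʳ _

  dilate-fall : ∀ δ δi μ y → δ * δi ≈ 1# → dilate δ (fall (μ * δi) y) ≋ fall μ (δ * y)
  dilate-fall δ δi μ y δδi≈1 zero    = *-identityˡ 1#
  dilate-fall δ δi μ y δδi≈1 (suc n) = begin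
    (δ * δ ^ n) * (fall (μ * δi) y n * (y - natR n * (μ * δi)))
      ≈⟨ regroup δ (δ ^ n) _ _ ⟩
    (δ ^ n * fall (μ * δi) y n) * (δ * (y - natR n * (μ * δi)))
      ≈⟨ *-cong (dilate-fall δ δi μ y δδi≈1 n) (RP.x[y-z]≈xy-xz δ y _) ⟩
    fall μ (δ * y) n * (δ * y - δ * (natR n * (μ * δi)))
      ≈⟨ *-cong refl (+-cong refl (-‿cong (trans (move δ (natR n) μ δi) (trans (*-cong refl δδi≈1) (*-identityʳ _))))) ⟩
    fall μ (δ * y) (suc n) ∎
    where
    regroup : ∀ d p f w → (d * p) * (f * w) ≈ (p * f) * (d * w)
    regroup = solve 4 (λ d p f w → (d :* p) :* (f :* w) := (p :* f) :* (d :* w)) refl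
    move : ∀ d k m e → d * (k * (m * e)) ≈ (k * m) * (d * e)
    move = solve 4 (λ d k m e → d :* (k :* (m :* e)) := (k :* m) :* (d :* e)) refl

  frobEuler-⋆ : ∀ μ v x (H : Seq) → IsDegFrobEuler μ v x H →
    (fall μ 1# ⊖ constS v) ⋆ H ≋ (1# - v) · fall μ x
  frobEuler-⋆ μ v x H isH n = trans (sym (egfMul≈⋆ _ H n)) (isH n)

  dilate-frobEuler : ∀ μ v y δ δi (G : Seq) → δ * δi ≈ 1# → IsDegFrobEuler (μ * δi) v y G →
    (fall μ δ ⊖ constS v) ⋆ dilate δ G ≋ (1# - v) · fall μ (δ * y)
  dilate-frobEuler μ v y δ δi G δδi≈1 isG n = begin
    ((fall μ δ ⊖ constS v) ⋆ dilate δ G) n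
      ≈⟨ ⋆-cong denominator (λ _ → refl) n ⟩
    (dilate δ (fall (μ * δi) 1# ⊖ constS v) ⋆ dilate δ G) n
      ≈⟨ sym (dilate-⋆ δ _ G n) ⟩
    δ ^ n * ((fall (μ * δi) 1# ⊖ constS v) ⋆ G) n
      ≈⟨ *-cong refl (frobEuler-⋆ (μ * δi) v y G isG n) ⟩
    δ ^ n * ((1# - v) * fall (μ * δi) y n)
      ≈⟨ *C.x∙yz≈y∙xz _ _ _ ⟩
    (1# - v) * (δ ^ n * fall (μ * δi) y n)
      ≈⟨ *-cong refl (dilate-fall δ δi μ y δδi≈1 n) ⟩
    (1# - v) * fall μ (δ * y) n ∎
    where
    denominator : fall μ δ ⊖ constS v ≋ dilate δ (fall (μ * δi) 1# ⊖ constS v)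
    denominator k = sym (begin
      δ ^ k * (fall (μ * δi) 1# k - constS v k)
        ≈⟨ RP.x[y-z]≈xy-xz _ _ _ ⟩
      δ ^ k * fall (μ * δi) 1# k - δ ^ k * constS v k
        ≈⟨ +-cong (trans (dilate-fall δ δi μ 1# δδi≈1 k) (fall-cong μ (*-identityʳ δ) k))
                  (-‿cong (dilate-const δ v k)) ⟩
      fall μ δ k - constS v k ∎)

  module Geometric (μ u : Carrier) where

    geometric : ℕ → Seq
    geometric m = Σˢ m (λ a → u ^ (m ∸ a) · fall μ (natR a))

    geometric-step : ∀ m → geometric (suc m) ≋ u · (geometric m ⊕ fall μ (natR m))
    geometric-step m n = weighted-sum-step u m (λ a → fall μ (natR a) n)

    geometric-⋆ : ∀ m x → geometric m ⋆ fall μ x ≋ Σˢ m (λ a → u ^ (m ∸ a) · fall μ (natR a + x))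
    geometric-⋆ m x n = trans (⋆-Σˢˡ m _ (fall μ x) n)
      (sumR-cong m (λ a _ → trans (⋆-·ˡ _ _ _ n) (*-cong refl (fall-⋆ μ (natR a) x n))))

    telescope : ∀ m → (fall μ 1# ⊖ constS u) ⋆ geometric m ≋ u · (fall μ (natR m) ⊖ constS (u ^ m))
    telescope zero n = trans (⋆-vanishes _ (geometric zero) n (λ _ _ → refl))
      (sym (trans (*-cong refl (trans (+-cong (fall-zero μ n) refl) (-‿inverseʳ _))) (zeroʳ u)))
    telescope (suc m) n = begin
      ((fall μ 1# ⊖ constS u) ⋆ geometric (suc m)) n
        ≈⟨ ⋆-cong (λ _ → refl) (geometric-step m) n ⟩
      ((fall μ 1# ⊖ constS u) ⋆ (u · (geometric m ⊕ fall μ (natR m)))) n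
        ≈⟨ trans (⋆-·ʳ u _ _ n) (*-cong refl (⋆-⊕ʳ _ _ _ n)) ⟩
      u * (((fall μ 1# ⊖ constS u) ⋆ geometric m) n + ((fall μ 1# ⊖ constS u) ⋆ fall μ (natR m)) n)
        ≈⟨ *-cong refl (+-cong (trans (telescope m n) (RP.x[y-z]≈xy-xz u _ _)) next-power) ⟩
      u * ((u * fall μ (natR m) n - u * constS (u ^ m) n) + (fall μ (natR (suc m)) n - u * fall μ (natR m) n))
        ≈⟨ *-cong refl (cancel-middle _ _ _) ⟩
      u * (fall μ (natR (suc m)) n - u * constS (u ^ m) n)
        ≈⟨ *-cong refl (+-cong refl (-‿cong (scale-const n))) ⟩
      u * (fall μ (natR (suc m)) n - constS (u ^ suc m) n) ∎
      where
      next-power : ((fall μ 1# ⊖ constS u) ⋆ fall μ (natR m)) n ≈ fall μ (natR (suc m)) n - u * fall μ (natR m) n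
      next-power = trans (⋆-⊖ˡ _ _ _ n) (+-cong (fall-⋆ μ 1# (natR m) n) (-‿cong (⋆-constˡ u _ n)))

      scale-const : u · constS (u ^ m) ≋ constS (u ^ suc m)
      scale-const zero    = refl
      scale-const (suc k) = zeroʳ u

  multiplication-formula : ∀ (μ u x δi ui wi : Carrier) (d : ℕ) →
    natR d * δi ≈ 1# → ui * u ≈ 1# → wi * (1# - u ^ d) ≈ 1# →
    (H : Seq) → IsDegFrobEuler μ u x H →
    (G : ℕ → Seq) → (∀ a → a < d → IsDegFrobEuler (μ * δi) (u ^ d) ((natR a + x) * δi) (G a)) →
    H ≋ ((- 1# + ui) * wi) · Σˢ d (λ a → u ^ (d ∸ a) · dilate (natR d) (G a))
  multiplication-formula μ u x δi ui wi d δδi≈1 uiu≈1 wiw≈1 H isH G isG =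
    ⋆-cancelˡ (u · P) H (c · Z) (ui * wi) leading-inverse (λ n → trans (uP⋆H n) (sym (uP⋆cZ n)))
    where
    open Geometric μ u using (geometric; geometric-⋆; telescope)

    δ c : Carrier
    δ = natR d
    c = (- 1# + ui) * wi

    P Q Z : Seq
    P = fall μ δ ⊖ constS (u ^ d)
    Q = geometric d
    Z = Σˢ d (λ a → u ^ (d ∸ a) · dilate δ (G a))

    -- the constant term of u P is u (1 - u^d)
    leading-inverse : (ui * wi) * (u * (1# - u ^ d)) ≈ 1#
    leading-inverse = trans (*C.interchange ui wi u _) (trans (*-cong uiu≈1 wiw≈1) (*-identityˡ 1#))

    c-leading : c * (u * (1# - u ^ d)) ≈ 1# - u
    c-leading = begin
      c * (u * (1# - u ^ d))                  ≈⟨ *C.interchange _ wi u _ ⟩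
      ((- 1# + ui) * u) * (wi * (1# - u ^ d)) ≈⟨ trans (*-cong refl wiw≈1) (*-identityʳ _) ⟩
      (- 1# + ui) * u                         ≈⟨ distribʳ u (- 1#) ui ⟩
      - 1# * u + ui * u                       ≈⟨ +-cong (RP.-1*x≈-x u) uiu≈1 ⟩
      - u + 1#                                ≈⟨ +-comm _ _ ⟩
      1# - u ∎

    -- each G_a(dt) is "(1 - u^d) / P · (1+μt)^{(a+x)/μ}"
    P⋆Z : P ⋆ Z ≋ (1# - u ^ d) · (Q ⋆ fall μ x)
    P⋆Z n = begin
      (P ⋆ Z) n
        ≈⟨ ⋆-Σˢʳ P d _ n ⟩
      sumR d (λ a → (P ⋆ (u ^ (d ∸ a) · dilate δ (G a))) n)
        ≈⟨ sumR-cong d term ⟩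
      sumR d (λ a → (1# - u ^ d) * (u ^ (d ∸ a) * fall μ (natR a + x) n))
        ≈⟨ sumR-* d _ _ ⟩
      (1# - u ^ d) * sumR d (λ a → u ^ (d ∸ a) * fall μ (natR a + x) n)
        ≈⟨ *-cong refl (sym (geometric-⋆ d x n)) ⟩
      (1# - u ^ d) * (Q ⋆ fall μ x) n ∎
      where
      rescale : ∀ y → δ * (y * δi) ≈ y
      rescale y = trans (*C.x∙yz≈y∙xz δ y δi) (trans (*-cong refl δδi≈1) (*-identityʳ y))

      term : ∀ a → a < d → (P ⋆ (u ^ (d ∸ a) · dilate δ (G a))) n ≈ (1# - u ^ d) * (u ^ (d ∸ a) * fall μ (natR a + x) n)
      term a a<d = begin
        (P ⋆ (u ^ (d ∸ a) · dilate δ (G a))) n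
          ≈⟨ ⋆-·ʳ _ P _ n ⟩
        u ^ (d ∸ a) * (P ⋆ dilate δ (G a)) n
          ≈⟨ *-cong refl (dilate-frobEuler μ (u ^ d) _ δ δi (G a) δδi≈1 (isG a a<d) n) ⟩
        u ^ (d ∸ a) * ((1# - u ^ d) * fall μ (δ * ((natR a + x) * δi)) n)
          ≈⟨ *-cong refl (*-cong refl (fall-cong μ (rescale (natR a + x)) n)) ⟩
        u ^ (d ∸ a) * ((1# - u ^ d) * fall μ (natR a + x) n)
          ≈⟨ *C.x∙yz≈y∙xz _ _ _ ⟩
        (1# - u ^ d) * (u ^ (d ∸ a) * fall μ (natR a + x) n) ∎

    uP⋆H : (u · P) ⋆ H ≋ (1# - u) · (Q ⋆ fall μ x)
    uP⋆H n = begin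
      ((u · P) ⋆ H) n                          ≈⟨ ⋆-cong (λ k → sym (telescope d k)) (λ _ → refl) n ⟩
      (((fall μ 1# ⊖ constS u) ⋆ Q) ⋆ H) n     ≈⟨ ⋆-cong (⋆-comm _ Q) (λ _ → refl) n ⟩
      ((Q ⋆ (fall μ 1# ⊖ constS u)) ⋆ H) n     ≈⟨ ⋆-assoc Q _ H n ⟩
      (Q ⋆ ((fall μ 1# ⊖ constS u) ⋆ H)) n     ≈⟨ ⋆-cong (λ _ → refl) (frobEuler-⋆ μ u x H isH) n ⟩
      (Q ⋆ ((1# - u) · fall μ x)) n            ≈⟨ ⋆-·ʳ _ Q _ n ⟩
      (1# - u) * (Q ⋆ fall μ x) n ∎

    uP⋆cZ : (u · P) ⋆ (c · Z) ≋ (1# - u) · (Q ⋆ fall μ x)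
    uP⋆cZ n = begin
      ((u · P) ⋆ (c · Z)) n                    ≈⟨ trans (⋆-·ʳ c _ Z n) (*-cong refl (⋆-·ˡ u P Z n)) ⟩
      c * (u * (P ⋆ Z) n)                      ≈⟨ *-cong refl (*-cong refl (P⋆Z n)) ⟩
      c * (u * ((1# - u ^ d) * (Q ⋆ fall μ x) n)) ≈⟨ regroup c u _ _ ⟩
      (c * (u * (1# - u ^ d))) * (Q ⋆ fall μ x) n ≈⟨ *-cong c-leading refl ⟩
      (1# - u) * (Q ⋆ fall μ x) n ∎
      where
      regroup : ∀ c u w X → c * (u * (w * X)) ≈ (c * (u * w)) * X
      regroup = solve 4 (λ c u w X → c :* (u :* (w :* X)) := (c :* (u :* w)) :* X) refl

-- The theorem for fields of characteristic zero: d = 0 is excluded by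
-- u^d ≠ 1, and for d ≥ 1 the numbers d, u and 1 - u^d are invertible.
theorem3 : ∀ {c ℓ} (F : CharZeroField c ℓ) → let open CharZeroField F in
    (lam u x : Carrier) (d : ℕ) →
    ¬ (lam ≈ 0#) → ¬ (u ≈ 0#) → ¬ (u ≈ 1#) → ¬ (u ^ d ≈ 1#) →
    (H : ℕ → Carrier) → IsDegFrobEuler lam u x H →
    (G : ℕ → ℕ → Carrier) →
    (∀ a → a < d →
      IsDegFrobEuler (lam * (natR d) ⁻¹) (u ^ d) ((natR a + x) * (natR d) ⁻¹) (G a)) →
    ∀ n → H n ≈ (natR d ^ n)
                 * (((- 1# + u ⁻¹) * (1# - u ^ d) ⁻¹)
                    * sumR d (λ a → u ^ (d ∸ a) * G a n))
theorem3 F lam u x zero _ _ _ u^0≉1 H isH G isG n = ⊥-elim (u^0≉1 (CharZeroField.refl F))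
theorem3 F lam u x d@(suc d-1) _ u≉0 _ u^d≉1 H isH G isG n = begin
    H n
      ≈⟨ multiplication-formula lam u x (δ ⁻¹) (u ⁻¹) ((1# - u ^ d) ⁻¹) d
           (⁻¹-inverse δ (charZero d-1)) (left-inverse u≉0) (left-inverse 1-u^d≉0) H isH G isG n ⟩
    c * sumR d (λ a → u ^ (d ∸ a) * (δ ^ n * G a n))
      ≈⟨ *-cong refl (trans (sumR-cong d (λ a _ → *C.x∙yz≈y∙xz _ _ _)) (sumR-* d (δ ^ n) _)) ⟩
    c * (δ ^ n * sumR d (λ a → u ^ (d ∸ a) * G a n))
      ≈⟨ *C.x∙yz≈y∙xz _ _ _ ⟩
    δ ^ n * (c * sumR d (λ a → u ^ (d ∸ a) * G a n)) ∎
  where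
  open CharZeroField F
  open SeriesAlgebra commutativeRing using (multiplication-formula; sumR-cong; sumR-*)
  open SetoidReasoning setoid
  module *C = CommSemigroupProperties *-commutativeSemigroup

  δ c : Carrier
  δ = natR d
  c = (- 1# + u ⁻¹) * (1# - u ^ d) ⁻¹

  left-inverse : ∀ {y} → ¬ (y ≈ 0#) → y ⁻¹ * y ≈ 1#
  left-inverse {y} y≉0 = trans (*-comm _ y) (⁻¹-inverse y y≉0)

  1-u^d≉0 : ¬ (1# - u ^ d ≈ 0#)
  1-u^d≉0 eq = u^d≉1 (sym (GroupProperties.x∙y⁻¹≈ε⇒x≈y +-group 1# (u ^ d) eq))
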